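{- Let $F$ be one of the life-like freezing cellular automata $T01, T02, T11, T12, S01, S02, S03, S11, S12, S13$, let $x$ be a configuration of $G(n)$, and let $$V_+=\Big\{v\in G(n): x_v=0,\ \textstyle\sum_{w\in N(v)}x_w\notin \mathcal{I}_F,\ \sum_{w\in N(v)}x_w+1\in\mathcal{I}_F\Big\}.$$ Let $u\in V_+$, let $G_+$ be the subgraph of the grid induced by $V_+$, let $V_+[u]$ be the vertex set of the connected component of $G_+$ containing $u$, and let $B[u]=\{v\notin V_+[u]: V_+[u]\cap N(v)\neq\emptyset\}$. Then $u$ is unstable (i.e. there exists a sequential update scheme that changes the state of $u$) if and only if some cell of $B[u]$ infiltrates.
   Context: Cells have two states, $0$ (inactive) and $1$ (active). In the triangular grid, $G(n)$ is a rhombus-shaped region of $2n^2$ triangular cells with periodic (torus) boundary, each cell having 3 neighbors (the cells sharing an edge with it); in the square grid, $G(n)$ is the $n\times n$ torus, each cell having 4 neighbors (von Neumann neighborhood). Adjacency in the grid graph is this neighbor relation. $N(v)$ denotes the set of neighbors of $v$ (not including $v$). For integers $0\le k_1\le k_2$, the life-like freezing rule with interval $\mathcal{I}_F=\{k_1,\dots,k_2\}$ is $F(x)_u=1$ if $x_u=1$ or $\sum_{w\in N(u)}x_w\in\mathcal{I}_F$, and $F(x)_u=0$ otherwise; it is named $Tk_1k_2$ on the triangular grid and $Sk_1k_2$ on the square grid. A sequential update scheme is a map $\sigma:\mathbb{N}\to G(n)$ such that each consecutive block of $|G(n)|$ time steps is a permutation of the cells; $F^{\sigma(0)}(x)=x$,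 and at time $t$ only cell $\sigma(t)$ is updated by the local rule. A cell $v$ is stable for $x$ if $F^{\sigma(t)}(x)_v=x_v$ for all $t\ge0$ and all sequential update schemes $\sigma$, and unstable otherwise. An inactive cell $v$ infiltrates if $\sum_{w\in N(v)}x_w\in\mathcal{I}_F$. -}

module Defs where

open import Data.Nat using (ℕ; zero; suc; _+_; _*_; _≤_; _<_)
open import Data.Fin using (Fin; toℕ; fromℕ<) renaming (zero to fz; suc to fs)
open import Data.Bool using (Bool; true; false)
open import Data.Product using (_×_; _,_; Σ; ∃)
open import Data.List using (List; []; _∷_; map)
open import Data.Nat.ListAction using (sum)
open import Data.List.Membership.Propositional using (_∈_)
open import Relation.Binary.PropositionalEquality using (_≡_)
open import Relation.Binary.Definitions using (DecidableEquality)
open import Data.Product.Properties using (≡-dec)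
import Data.Bool
open import Relation.Nullary using (¬_; yes; no)
open import Data.Nat using (_<?_)

sucMod : ∀ {n} → Fin n → Fin n
sucMod {suc m} i with suc (toℕ i) <? suc m
... | yes p = fromℕ< p
... | no _  = fz

predMod : ∀ {n} → Fin n → Fin n
predMod {suc m} fz     = Data.Fin.fromℕ m
predMod {suc m} (fs i) = Data.Fin.inject₁ i

data Grid : Set where
  Tri Sq : Grid

-- Triangular torus G(n): rhombus of n×n parallelograms, each split into
-- an "up" triangle (false) and a "down" triangle (true): 2n² cells.
-- Square torus G(n): n×n cells.
Cell : Grid → ℕ → Set
Cell Tri n = Fin n × Fin n × Bool
Cell Sq  n = Fin n × Fin n

size : Grid → ℕ → ℕ
size Tri n = 2 * (n * n)
size Sq  n = n * n

nbrs : (g : Grid) {n : ℕ} → Cell g n → List (Cell g n)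
nbrs Tri (i , j , false) = (i , j , true) ∷ (predMod i , j , true) ∷ (i , predMod j , true) ∷ []
nbrs Tri (i , j , true)  = (i , j , false) ∷ (sucMod i , j , false) ∷ (i , sucMod j , false) ∷ []
nbrs Sq  (i , j) = (sucMod i , j) ∷ (predMod i , j) ∷ (i , sucMod j) ∷ (i , predMod j) ∷ []

-- sizes for which the neighbourhoods are 3 (resp. 4) distinct cells
ValidSize : Grid → ℕ → Set
ValidSize Tri n = 2 ≤ n
ValidSize Sq  n = 3 ≤ n

data Rule : Set where
  T01 T02 T11 T12 S01 S02 S03 S11 S12 S13 : Rule

grid : Rule → Grid
grid T01 = Tri
grid T02 = Tri
grid T11 = Tri
grid T12 = Tri
grid _   = Sq

k₁ : Rule → ℕ
k₁ T01 = 0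
k₁ T02 = 0
k₁ S01 = 0
k₁ S02 = 0
k₁ S03 = 0
k₁ _   = 1

k₂ : Rule → ℕ
k₂ T01 = 1
k₂ T02 = 2
k₂ T11 = 1
k₂ T12 = 2
k₂ S01 = 1
k₂ S02 = 2
k₂ S03 = 3
k₂ S11 = 1
k₂ S12 = 2
k₂ S13 = 3

InI : Rule → ℕ → Set
InI F s = k₁ F ≤ s × s ≤ k₂ F

Config : Rule → ℕ → Set
Config F n = Cell (grid F) n → Bool

b2n : Bool → ℕ
b2n false = 0
b2n true  = 1

nsum : (F : Rule) {n : ℕ} → Config F n → Cell (grid F) n → ℕ
nsum F x v = sum (map (λ w → b2n (x w)) (nbrs (grid F) v))

localRule : (F : Rule) {n : ℕ} → Config F n → Cell (grid F) n → Bool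
localRule F x v with x v
... | true  = true
... | false with k₁ F Data.Nat.≤? nsum F x v | nsum F x v Data.Nat.≤? k₂ F
...   | yes _ | yes _ = true
...   | _     | _     = false

cellEq? : (g : Grid) {n : ℕ} → DecidableEquality (Cell g n)
cellEq? Tri = ≡-dec Data.Fin._≟_ (≡-dec Data.Fin._≟_ Data.Bool._≟_)
cellEq? Sq  = ≡-dec Data.Fin._≟_ Data.Fin._≟_

updateAt : (F : Rule) {n : ℕ} → Cell (grid F) n → Config F n → Config F n
updateAt F u x v with cellEq? (grid F) u v
... | yes _ = localRule F x u
... | no _  = x v

IsSeqScheme : (F : Rule) (n : ℕ) → (ℕ → Cell (grid F) n) → Set
IsSeqScheme F n σ =
  ∀ (k : ℕ) →
    (∀ (i j : ℕ) → i < size (grid F) n → j < size (grid F) n →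
       σ (k * size (grid F) n + i) ≡ σ (k * size (grid F) n + j) → i ≡ j)
  × (∀ (v : Cell (grid F) n) → Σ ℕ λ i → i < size (grid F) n × σ (k * size (grid F) n + i) ≡ v)

run : (F : Rule) {n : ℕ} → (ℕ → Cell (grid F) n) → Config F n → ℕ → Config F n
run F σ x zero    = x
run F σ x (suc t) = updateAt F (σ t) (run F σ x t)

Stable : (F : Rule) (n : ℕ) → Config F n → Cell (grid F) n → Set
Stable F n x v = ∀ (σ : ℕ → Cell (grid F) n) → IsSeqScheme F n σ →
                 ∀ (t : ℕ) → run F σ x t v ≡ x v

Unstable : (F : Rule) (n : ℕ) → Config F n → Cell (grid F) n → Set
Unstable F n x v = ¬ Stable F n x v

InVplus : (F : Rule) {n : ℕ} → Config F n → Cell (grid F) n → Set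
InVplus F x v = x v ≡ false × ¬ InI F (nsum F x v) × InI F (suc (nsum F x v))

data InComp (F : Rule) {n : ℕ} (x : Config F n) (u : Cell (grid F) n) : Cell (grid F) n → Set where
  here : InVplus F x u → InComp F x u u
  step : ∀ {w v} → InComp F x u w → v ∈ nbrs (grid F) w → InVplus F x v → InComp F x u v

InBorder : (F : Rule) {n : ℕ} → Config F n → Cell (grid F) n → Cell (grid F) n → Set
InBorder F x u v = ¬ InComp F x u v × ∃ λ w → InComp F x u w × w ∈ nbrs (grid F) v

Infiltrates : (F : Rule) {n : ℕ} → Config F n → Cell (grid F) n → Set
Infiltrates F x v = x v ≡ false × InI F (nsum F x v)

module Submission where

-- For the ten rules considered k₁ ≤ 1, so V₊ is non-empty only when k₁ = 1,
-- and then the cells of V₊ have no active neighbour at all.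
--
-- (⇐) Take an infiltrating border cell v and a SHORTEST walk v = c₀, c₁, …, c_k = u with
--   c₁, …, c_k in V₊.  Minimality makes it an induced path: c_{i+1} has c_i as its only
--   neighbour among c₀, …, c_i.  Updating c₀, c₁, …, c_k in this order (and the remaining
--   cells afterwards, which yields a sequential update scheme) activates every c_i in
--   turn, since each then has exactly one active neighbour and 1 ∈ I_F.  So u changes.
-- (⇒) If no border cell infiltrates, every border cell has more than k₂ active
--   neighbours, and this persists because cells never deactivate; every cell of V₊[u]
--   only has neighbours in V₊[u] ∪ B[u].  Hence V₊[u] ∪ B[u] stays inactive forever.
--   Constructively, "some border cell infiltrates" is decided by a bounded search for
--   infiltrating cells joined to u by a short walk through V₊.

open import Defs
open import Data.Bool using (Bool; true; false)
import Data.Bool as Bool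
open import Data.Empty using (⊥-elim)
open import Data.Fin using (Fin; toℕ; fromℕ; fromℕ<; inject₁) renaming (zero to fz; suc to fs)
open import Data.Fin.Properties using (toℕ-injective; toℕ-fromℕ<; toℕ-fromℕ; toℕ-inject₁; toℕ<n)
open import Data.List using (List; []; _∷_; map; _++_; length; lookup; filter; cartesianProduct; allFin)
open import Data.List.Properties using (length-++; length-++-≤ˡ; length-map; length-tabulate)
open import Data.List.Membership.Propositional using (_∈_; _∉_; find; lose)
open import Data.List.Membership.Propositional.Properties
  using (∈-cartesianProduct⁺; ∈-allFin; ∈-lookup; ∈-++⁺ˡ; ∈-++⁺ʳ; ∈-filter⁺; ∈-filter⁻; ∈-length)
open import Data.List.Membership.Propositional.Properties.WithK using (unique∧set⇒bag)
import Data.List.Membership.DecPropositional as DecMembership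
open import Data.List.Relation.Binary.BagAndSetEquality using (∼bag⇒↭)
open import Data.List.Relation.Binary.Permutation.Propositional.Properties using (↭-length)
open import Data.List.Relation.Unary.Any using (Any; here; there; any?; index)
open import Data.List.Relation.Unary.Any.Properties using (lookup-index)
import Data.List.Relation.Unary.All as All
open import Data.List.Relation.Unary.All using ([]; _∷_)
open import Data.List.Relation.Unary.AllPairs using ([]; _∷_)
open import Data.List.Relation.Unary.Unique.Propositional using (Unique)
open import Data.List.Relation.Unary.Unique.Propositional.Properties
  using (cartesianProduct⁺; allFin⁺; ++⁺; filter⁺)
open import Data.Nat using (ℕ; zero; suc; _+_; _*_; _≤_; _<_; z≤n; s≤s; _≤?_; _<?_; NonZero; >-nonZero)
open import Data.Nat.DivMod using (_%_; m%n<n; [m+kn]%n≡m%n; m<n⇒m%n≡m)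
open import Data.Nat.Induction using (<-rec)
open import Data.Nat.ListAction using (sum)
open import Data.Nat.Properties
open import Data.Product using (_×_; _,_; Σ; ∃; proj₁; proj₂)
open import Data.Sum using (_⊎_; inj₁; inj₂)
open import Function using (_∘_)
open import Function.Bundles using (_⇔_; mk⇔)
open import Relation.Binary.Definitions using (DecidableEquality)
open import Relation.Binary.PropositionalEquality
open import Relation.Nullary using (¬_; Dec; yes; no)
open import Relation.Nullary.Decidable using (_×-dec_; ¬?; map′)

sucMod-cases : ∀ {n} (i : Fin n) →
               toℕ (sucMod i) ≡ suc (toℕ i) ⊎ (toℕ (sucMod i) ≡ 0 × suc (toℕ i) ≡ n)
sucMod-cases {suc m} i with suc (toℕ i) <? suc m
... | yes p = inj₁ (toℕ-fromℕ< p)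
... | no ¬p = inj₂ (refl , cong suc (≤-antisym (≤-pred (toℕ<n i)) (≮⇒≥ (¬p ∘ s≤s))))

sucMod-step : ∀ {n} (i j : Fin n) → toℕ j ≡ suc (toℕ i) → sucMod i ≡ j
sucMod-step {suc m} i j j≡1+i with suc (toℕ i) <? suc m
... | yes p = toℕ-injective (trans (toℕ-fromℕ< p) (sym j≡1+i))
... | no ¬p = ⊥-elim (¬p (subst (_< suc m) j≡1+i (toℕ<n j)))

sucMod-wrap : ∀ {m} (i : Fin (suc m)) → toℕ i ≡ m → sucMod i ≡ fz
sucMod-wrap {m} i i≡m with suc (toℕ i) <? suc m
... | yes p = ⊥-elim (<-irrefl refl (subst (λ k → suc k < suc m) i≡m p))
... | no _  = refl

predMod-step : ∀ {n} (i j : Fin n) → toℕ i ≡ suc (toℕ j) → predMod i ≡ j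
predMod-step {suc m} (fs i) j i≡1+j = toℕ-injective (trans (toℕ-inject₁ i) (suc-injective i≡1+j))

sucMod-predMod : ∀ {n} (i : Fin n) → sucMod (predMod i) ≡ i
sucMod-predMod {suc m} fz     = sucMod-wrap (fromℕ m) (toℕ-fromℕ m)
sucMod-predMod {suc m} (fs i) = sucMod-step (inject₁ i) (fs i) (cong suc (sym (toℕ-inject₁ i)))

predMod-sucMod : ∀ {n} (i : Fin n) → predMod (sucMod i) ≡ i
predMod-sucMod {suc m} i with suc (toℕ i) <? suc m
... | yes p = predMod-step (fromℕ< p) i (toℕ-fromℕ< p)
... | no ¬p = toℕ-injective (trans (toℕ-fromℕ m) (≤-antisym (≮⇒≥ (¬p ∘ s≤s)) (≤-pred (toℕ<n i))))

sucMod-moves : ∀ {n} → 2 ≤ n → (i : Fin n) → sucMod i ≢ i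
sucMod-moves 2≤n i eq with sucMod-cases i
... | inj₁ e            = <-irrefl (trans (sym (cong toℕ eq)) e) (n<1+n (toℕ i))
... | inj₂ (e , 1+i≡n) = <-irrefl (trans (sym (cong suc (trans (cong toℕ (sym eq)) e))) 1+i≡n) 2≤n

predMod-moves : ∀ {n} → 2 ≤ n → (i : Fin n) → predMod i ≢ i
predMod-moves 2≤n i eq = sucMod-moves 2≤n i (trans (sym (cong sucMod eq)) (sucMod-predMod i))

sucMod²-moves : ∀ {n} → 3 ≤ n → (i : Fin n) → sucMod (sucMod i) ≢ i
sucMod²-moves 3≤n i eq with sucMod-cases i | sucMod-cases (sucMod i) | cong toℕ eq
... | inj₁ e₁ | inj₁ e₂ | e₃ =
  <-irrefl (trans (sym e₃) (trans e₂ (cong suc e₁))) (m<n⇒m<1+n (n<1+n (toℕ i)))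
... | inj₁ e₁ | inj₂ (z₂ , n₂) | e₃ =
  <-irrefl (sym (trans (sym n₂) (cong suc (trans e₁ (cong suc (trans (sym e₃) z₂)))))) 3≤n
... | inj₂ (z₁ , n₁) | inj₁ e₂ | e₃ =
  <-irrefl (sym (trans (sym n₁) (cong suc (trans (sym e₃) (trans e₂ (cong suc z₁)))))) 3≤n
... | inj₂ (z₁ , _) | inj₂ (_ , n₂) | _ =
  <-irrefl (sym (trans (sym n₂) (cong suc z₁))) (≤-trans (s≤s (s≤s z≤n)) 3≤n)

sucMod≢predMod : ∀ {n} → 3 ≤ n → (i : Fin n) → sucMod i ≢ predMod i
sucMod≢predMod 3≤n i eq = sucMod²-moves 3≤n i (trans (cong sucMod eq) (sucMod-predMod i))

-- Two duplicate-free lists that both contain every element are permutations of each other,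
-- hence have the same length.
length-unique-complete : ∀ {A : Set} {xs ys : List A} → Unique xs → Unique ys →
                         (∀ a → a ∈ xs) → (∀ a → a ∈ ys) → length xs ≡ length ys
length-unique-complete ux uy ∈xs ∈ys =
  ↭-length (∼bag⇒↭ (unique∧set⇒bag ux uy (mk⇔ (λ _ → ∈ys _) (λ _ → ∈xs _))))

-- Given a duplicate-free enumeration of a type with decidable equality, every
-- duplicate-free list extends to a duplicate-free enumeration (itself followed by the
-- missing elements), and so is at most as long as the enumeration.
module Enumeration {A : Set} (_≟_ : DecidableEquality A) {elems : List A}
                   (∈-elems : ∀ a → a ∈ elems) (elems-unique : Unique elems) where

  open DecMembership _≟_ using (_∈?_)

  extend : List A → List A
  extend ℓ = ℓ ++ filter (λ a → ¬? (a ∈? ℓ)) elems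

  ∈-extend : ∀ ℓ a → a ∈ extend ℓ
  ∈-extend ℓ a with a ∈? ℓ
  ... | yes a∈ℓ = ∈-++⁺ˡ a∈ℓ
  ... | no  a∉ℓ = ∈-++⁺ʳ ℓ (∈-filter⁺ (λ b → ¬? (b ∈? ℓ)) (∈-elems a) a∉ℓ)

  extend-unique : ∀ {ℓ} → Unique ℓ → Unique (extend ℓ)
  extend-unique {ℓ} uℓ = ++⁺ uℓ (filter⁺ P? elems-unique)
    (λ (a∈ℓ , a∈rest) → proj₂ (∈-filter⁻ P? {xs = elems} a∈rest) a∈ℓ)
    where P? = λ b → ¬? (b ∈? ℓ)

  length-extend : ∀ {ℓ} → Unique ℓ → length (extend ℓ) ≡ length elems
  length-extend {ℓ} uℓ = length-unique-complete (extend-unique uℓ) elems-unique (∈-extend ℓ) ∈-elems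

  length-unique≤ : ∀ {ℓ} → Unique ℓ → length ℓ ≤ length elems
  length-unique≤ {ℓ} uℓ = ≤-trans (length-++-≤ˡ ℓ) (≤-reflexive (length-extend uℓ))

lookup-injective : ∀ {A : Set} {xs : List A} → Unique xs →
                   ∀ {i j} → lookup xs i ≡ lookup xs j → i ≡ j
lookup-injective {xs = _ ∷ _} (_ ∷ _)    {fz}   {fz}   _ = refl
lookup-injective {xs = _ ∷ _} (x∉ ∷ _)  {fz}   {fs j} e = ⊥-elim (All.lookup x∉ (∈-lookup j) e)
lookup-injective {xs = _ ∷ _} (x∉ ∷ _)  {fs i} {fz}   e = ⊥-elim (All.lookup x∉ (∈-lookup i) (sym e))
lookup-injective {xs = _ ∷ _} (_ ∷ uxs) {fs i} {fs j} e = cong fs (lookup-injective uxs e)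

lookup-++ˡ : ∀ {A : Set} (ℓ r : List A) (i : Fin (length ℓ)) (j : Fin (length (ℓ ++ r))) →
             toℕ j ≡ toℕ i → lookup (ℓ ++ r) j ≡ lookup ℓ i
lookup-++ˡ (_ ∷ _) r fz     fz     _ = refl
lookup-++ˡ (_ ∷ ℓ) r (fs i) (fs j) e = lookup-++ˡ ℓ r i j (suc-injective e)

module Cyclic {A : Set} (xs : List A) .{{_ : NonZero (length xs)}} where

  position : ℕ → Fin (length xs)
  position m = fromℕ< (m%n<n m (length xs))

  cyclic : ℕ → A
  cyclic m = lookup xs (position m)

  position-block : ∀ k {i} → i < length xs → toℕ (position (k * length xs + i)) ≡ i
  position-block k {i} i<L = begin
    toℕ (position (k * L + i)) ≡⟨ toℕ-fromℕ< _ ⟩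
    (k * L + i) % L            ≡⟨ cong (_% L) (+-comm (k * L) i) ⟩
    (i + k * L) % L            ≡⟨ [m+kn]%n≡m%n i k L ⟩
    i % L                      ≡⟨ m<n⇒m%n≡m i<L ⟩
    i                          ∎
    where open ≡-Reasoning
          L = length xs

  cyclic-block-injective : Unique xs → ∀ k {i j} → i < length xs → j < length xs →
                           cyclic (k * length xs + i) ≡ cyclic (k * length xs + j) → i ≡ j
  cyclic-block-injective uxs k i<L j<L e =
    trans (sym (position-block k i<L)) (trans (cong toℕ (lookup-injective uxs e)) (position-block k j<L))

  cyclic-block-surjective : ∀ k {a} → a ∈ xs → Σ ℕ λ i → i < length xs × cyclic (k * length xs + i) ≡ a
  cyclic-block-surjective k a∈xs =
    toℕ (index a∈xs) , toℕ<n (index a∈xs) ,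
    trans (cong (lookup xs) (toℕ-injective (position-block k (toℕ<n (index a∈xs))))) (sym (lookup-index a∈xs))

count : {A : Set} → (A → Bool) → List A → ℕ
count y l = sum (map (λ a → b2n (y a)) l)

count-zero : ∀ {A : Set} (y : A → Bool) l → (∀ {a} → a ∈ l → y a ≡ false) → count y l ≡ 0
count-zero y []      _   = refl
count-zero y (a ∷ l) off rewrite off (here refl) = count-zero y l (off ∘ there)

count-zero⁻ : ∀ {A : Set} (y : A → Bool) l → count y l ≡ 0 → ∀ {a} → a ∈ l → y a ≡ false
count-zero⁻ y (b ∷ l) e (here refl) with y b
... | false = refl
count-zero⁻ y (b ∷ l) e (there a∈l) with y b
... | false = count-zero⁻ y l e a∈l

count-one : ∀ {A : Set} (y : A → Bool) l {e} → Unique l → e ∈ l → y e ≡ true →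
            (∀ {a} → a ∈ l → a ≢ e → y a ≡ false) → count y l ≡ 1
count-one y (b ∷ l) (b∉ ∷ _) (here refl) on off rewrite on =
  cong suc (count-zero y l (λ a∈l → off (there a∈l) (λ eq → All.lookup b∉ a∈l (sym eq))))
count-one y (b ∷ l) (b∉ ∷ ul) (there e∈l) on off rewrite off (here refl) (λ eq → All.lookup b∉ e∈l eq) =
  count-one y l ul e∈l on (off ∘ there)

count-mono : ∀ {A : Set} (y z : A → Bool) l → (∀ a → y a ≡ true → z a ≡ true) → count y l ≤ count z l
count-mono y z []      y⊆z = z≤n
count-mono y z (a ∷ l) y⊆z with y a in ya | z a in za
... | false | false = count-mono y z l y⊆z
... | false | true  = m≤n⇒m≤1+n (count-mono y z l y⊆z)
... | true  | true  = s≤s (count-mono y z l y⊆z)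
... | true  | false with () ← trans (sym (y⊆z a ya)) za

nbr-sym : (g : Grid) {n : ℕ} {c d : Cell g n} → c ∈ nbrs g d → d ∈ nbrs g c
nbr-sym Tri {d = i , j , false} (here refl)                 = here refl
nbr-sym Tri {d = i , j , false} (there (here refl))         = there (here (cong (λ a → a , j , false) (sym (sucMod-predMod i))))
nbr-sym Tri {d = i , j , false} (there (there (here refl))) = there (there (here (cong (λ a → i , a , false) (sym (sucMod-predMod j)))))
nbr-sym Tri {d = i , j , true}  (here refl)                 = here refl
nbr-sym Tri {d = i , j , true}  (there (here refl))         = there (here (cong (λ a → a , j , true) (sym (predMod-sucMod i))))
nbr-sym Tri {d = i , j , true}  (there (there (here refl))) = there (there (here (cong (λ a → i , a , true) (sym (predMod-sucMod j)))))
nbr-sym Sq  {d = i , j} (here refl)                         = there (here (cong (λ a → a , j) (sym (predMod-sucMod i))))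
nbr-sym Sq  {d = i , j} (there (here refl))                 = here (cong (λ a → a , j) (sym (sucMod-predMod i)))
nbr-sym Sq  {d = i , j} (there (there (here refl)))         = there (there (there (here (cong (λ a → i , a) (sym (predMod-sucMod j))))))
nbr-sym Sq  {d = i , j} (there (there (there (here refl)))) = there (there (here (cong (λ a → i , a) (sym (sucMod-predMod j)))))

validSize⇒2≤n : (g : Grid) {n : ℕ} → ValidSize g n → 2 ≤ n
validSize⇒2≤n Tri 2≤n = 2≤n
validSize⇒2≤n Sq  3≤n = ≤-trans (s≤s (s≤s z≤n)) 3≤n

nbrs-unique : (g : Grid) {n : ℕ} → ValidSize g n → (c : Cell g n) → Unique (nbrs g c)
nbrs-unique Tri 2≤n (i , j , false) =
  ((λ e → predMod-moves 2≤n i (sym (cong proj₁ e))) ∷ (λ e → predMod-moves 2≤n j (sym (cong (proj₁ ∘ proj₂) e))) ∷ [])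
  ∷ ((λ e → predMod-moves 2≤n i (cong proj₁ e)) ∷ []) ∷ [] ∷ []
nbrs-unique Tri 2≤n (i , j , true) =
  ((λ e → sucMod-moves 2≤n i (sym (cong proj₁ e))) ∷ (λ e → sucMod-moves 2≤n j (sym (cong (proj₁ ∘ proj₂) e))) ∷ [])
  ∷ ((λ e → sucMod-moves 2≤n i (cong proj₁ e)) ∷ []) ∷ [] ∷ []
nbrs-unique Sq 3≤n (i , j) =
  ((λ e → sucMod≢predMod 3≤n i (cong proj₁ e)) ∷ (λ e → sucMod-moves 2≤n i (cong proj₁ e)) ∷ (λ e → sucMod-moves 2≤n i (cong proj₁ e)) ∷ [])
  ∷ ((λ e → predMod-moves 2≤n i (cong proj₁ e)) ∷ (λ e → predMod-moves 2≤n i (cong proj₁ e)) ∷ [])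
  ∷ ((λ e → sucMod≢predMod 3≤n j (cong proj₂ e)) ∷ []) ∷ [] ∷ []
  where 2≤n = validSize⇒2≤n Sq 3≤n

allCells : (g : Grid) (n : ℕ) → List (Cell g n)
allCells Tri n = cartesianProduct (allFin n) (cartesianProduct (allFin n) (false ∷ true ∷ []))
allCells Sq  n = cartesianProduct (allFin n) (allFin n)

∈-allCells : (g : Grid) {n : ℕ} (c : Cell g n) → c ∈ allCells g n
∈-allCells Tri (i , j , b) = ∈-cartesianProduct⁺ (∈-allFin i) (∈-cartesianProduct⁺ (∈-allFin j) (∈-bools b))
  where
  ∈-bools : (b : Bool) → b ∈ false ∷ true ∷ []
  ∈-bools false = here refl
  ∈-bools true  = there (here refl)
∈-allCells Sq  (i , j)     = ∈-cartesianProduct⁺ (∈-allFin i) (∈-allFin j)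

allCells-unique : (g : Grid) (n : ℕ) → Unique (allCells g n)
allCells-unique Tri n = cartesianProduct⁺ (allFin⁺ n) (cartesianProduct⁺ (allFin⁺ n) (((λ ()) ∷ []) ∷ [] ∷ []))
allCells-unique Sq  n = cartesianProduct⁺ (allFin⁺ n) (allFin⁺ n)

length-cartesianProduct : ∀ {A B : Set} (xs : List A) (ys : List B) →
                          length (cartesianProduct xs ys) ≡ length xs * length ys
length-cartesianProduct []       ys = refl
length-cartesianProduct (a ∷ xs) ys =
  trans (length-++ (map (a ,_) ys)) (cong₂ _+_ (length-map (a ,_) ys) (length-cartesianProduct xs ys))

length-allFin : ∀ n → length (allFin n) ≡ n
length-allFin n = length-tabulate (λ i → i)

length-allCells : (g : Grid) (n : ℕ) → length (allCells g n) ≡ size g n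
length-allCells Tri n = begin
  length (allCells Tri n)                          ≡⟨ length-cartesianProduct (allFin n) _ ⟩
  length (allFin n) * length (cartesianProduct (allFin n) (false ∷ true ∷ []))
    ≡⟨ cong₂ _*_ (length-allFin n) (trans (length-cartesianProduct (allFin n) _) (cong (_* 2) (length-allFin n))) ⟩
  n * (n * 2)                                      ≡⟨ cong (n *_) (*-comm n 2) ⟩
  n * (2 * n)                                      ≡⟨ sym (*-assoc n 2 n) ⟩
  n * 2 * n                                        ≡⟨ cong (_* n) (*-comm n 2) ⟩
  2 * n * n                                        ≡⟨ *-assoc 2 n n ⟩
  2 * (n * n)                                      ∎
  where open ≡-Reasoning
length-allCells Sq  n =
  trans (length-cartesianProduct (allFin n) (allFin n)) (cong₂ _*_ (length-allFin n) (length-allFin n))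

k₁≤1 : ∀ F → k₁ F ≤ 1
k₁≤1 T01 = z≤n
k₁≤1 T02 = z≤n
k₁≤1 T11 = ≤-refl
k₁≤1 T12 = ≤-refl
k₁≤1 S01 = z≤n
k₁≤1 S02 = z≤n
k₁≤1 S03 = z≤n
k₁≤1 S11 = ≤-refl
k₁≤1 S12 = ≤-refl
k₁≤1 S13 = ≤-refl

1≤k₂ : ∀ F → 1 ≤ k₂ F
1≤k₂ T01 = ≤-refl
1≤k₂ T02 = s≤s z≤n
1≤k₂ T11 = ≤-refl
1≤k₂ T12 = s≤s z≤n
1≤k₂ S01 = ≤-refl
1≤k₂ S02 = s≤s z≤n
1≤k₂ S03 = s≤s z≤n
1≤k₂ S11 = ≤-refl
1≤k₂ S12 = s≤s z≤n
1≤k₂ S13 = s≤s z≤n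

enter-at-k₁ : ∀ F {s} → ¬ InI F s → InI F (suc s) → suc s ≡ k₁ F
enter-at-k₁ F {s} s∉I (k₁≤1+s , 1+s≤k₂) =
  ≤-antisym (≰⇒> (λ k₁≤s → s∉I (k₁≤s , ≤-trans (n≤1+n s) 1+s≤k₂))) k₁≤1+s

vplus-threshold : ∀ F {s} → ¬ InI F s → InI F (suc s) → s ≡ 0 × k₁ F ≡ 1
vplus-threshold F s∉I 1+s∈I with enter-at-k₁ F s∉I 1+s∈I
... | 1+s≡k₁ = s≡0 , trans (sym 1+s≡k₁) (cong suc s≡0)
  where s≡0 = n≤0⇒n≡0 (≤-pred (subst (_≤ 1) (sym 1+s≡k₁) (k₁≤1 F)))

module Threshold (F : Rule) (k₁≡1 : k₁ F ≡ 1) where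

  1∈I : InI F 1
  1∈I = ≤-reflexive k₁≡1 , 1≤k₂ F

  0∉I : ¬ InI F 0
  0∉I (k₁≤0 , _) with () ← subst (_≤ 0) k₁≡1 k₁≤0

  above-I : ∀ s → ¬ InI F s → ¬ InI F (suc s) → k₂ F < s
  above-I zero    _   1∉I = ⊥-elim (1∉I 1∈I)
  above-I (suc s) s∉I _   = ≰⇒> (λ s≤k₂ → s∉I (subst (_≤ suc s) (sym k₁≡1) (s≤s z≤n) , s≤k₂))

InI? : ∀ F s → Dec (InI F s)
InI? F s = (k₁ F ≤? s) ×-dec (s ≤? k₂ F)

module Dynamics (F : Rule) {n : ℕ} where

  private
    g = grid F
    C = Cell g n

  localRule-infiltrates : ∀ {y : Config F n} {c} → y c ≡ false → InI F (nsum F y c) → localRule F y c ≡ true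
  localRule-infiltrates {y} {c} yc (k₁≤s , s≤k₂) rewrite yc with k₁ F ≤? nsum F y c | nsum F y c ≤? k₂ F
  ... | yes _ | yes _   = refl
  ... | no ¬a | _       = ⊥-elim (¬a k₁≤s)
  ... | yes _ | no ¬b   = ⊥-elim (¬b s≤k₂)

  localRule-idle : ∀ {y : Config F n} {c} → y c ≡ false → ¬ InI F (nsum F y c) → localRule F y c ≡ false
  localRule-idle {y} {c} yc s∉I rewrite yc with k₁ F ≤? nsum F y c | nsum F y c ≤? k₂ F
  ... | yes a | yes b = ⊥-elim (s∉I (a , b))
  ... | no _  | _     = refl
  ... | yes _ | no _  = refl

  updateAt-self : ∀ {y : Config F n} {c} → updateAt F c y c ≡ localRule F y c
  updateAt-self {y} {c} with cellEq? g c c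
  ... | yes _ = refl
  ... | no c≢c = ⊥-elim (c≢c refl)

  updateAt-other : ∀ {y : Config F n} {c e} → c ≢ e → updateAt F c y e ≡ y e
  updateAt-other {y} {c} {e} c≢e with cellEq? g c e
  ... | yes c≡e = ⊥-elim (c≢e c≡e)
  ... | no _    = refl

  updateAt-active : ∀ {y : Config F n} {d c} → y c ≡ true → updateAt F d y c ≡ true
  updateAt-active {y} {d} {c} yc with cellEq? g d c
  ... | yes refl rewrite yc = refl
  ... | no _ = yc

  run-active : ∀ (x : Config F n) σ t {c} → x c ≡ true → run F σ x t c ≡ true
  run-active x σ zero    xc = xc
  run-active x σ (suc t) xc = updateAt-active (run-active x σ t xc)

  stays-inactive : (x : Config F n) (P : C → Set) → (∀ {c} → P c → x c ≡ false) →
                   (∀ (y : Config F n) {c} → (∀ {e} → P e → y e ≡ false) → (∀ {e} → x e ≡ true → y e ≡ true) →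
                      P c → localRule F y c ≡ false) →
                   ∀ σ t {c} → P c → run F σ x t c ≡ false
  stays-inactive x P init closed σ zero    Pc = init Pc
  stays-inactive x P init closed σ (suc t) {c} Pc with cellEq? g (σ t) c
  ... | yes refl = closed (run F σ x t) (stays-inactive x P init closed σ t) (run-active x σ t) Pc
  ... | no _     = stays-inactive x P init closed σ t Pc

  updateAlong : List C → Config F n → Config F n
  updateAlong []       y = y
  updateAlong (c ∷ cs) y = updateAlong cs (updateAt F c y)

  run-along : ∀ (x : Config F n) σ (ℓ : List C) s → (∀ (i : Fin (length ℓ)) → σ (s + toℕ i) ≡ lookup ℓ i) →
              run F σ x (s + length ℓ) ≡ updateAlong ℓ (run F σ x s)
  run-along x σ []       s _      = cong (run F σ x) (+-identityʳ s)
  run-along x σ (c ∷ cs) s visits = begin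
    run F σ x (s + suc (length cs))           ≡⟨ cong (run F σ x) (+-suc s (length cs)) ⟩
    run F σ x (suc s + length cs)             ≡⟨ run-along x σ cs (suc s) (λ i → trans (cong σ (sym (+-suc s (toℕ i)))) (visits (fs i))) ⟩
    updateAlong cs (run F σ x (suc s))        ≡⟨ cong (λ d → updateAlong cs (updateAt F d (run F σ x s))) σs≡c ⟩
    updateAlong (c ∷ cs) (run F σ x s)        ∎
    where
    open ≡-Reasoning
    σs≡c : σ s ≡ c
    σs≡c = trans (cong σ (sym (+-identityʳ s))) (visits fz)

  scheme-starting-with : (ℓ : List C) → Unique ℓ → ∀ {c} → c ∈ ℓ →
                         Σ (ℕ → C) λ σ → IsSeqScheme F n σ × (∀ (i : Fin (length ℓ)) → σ (0 + toℕ i) ≡ lookup ℓ i)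
  scheme-starting-with ℓ uℓ c∈ℓ = cyclic , scheme , prefix
    where
    open Enumeration (cellEq? g) (∈-allCells g) (allCells-unique g n)
    order = extend ℓ
    L≡N : length order ≡ size g n
    L≡N = trans (length-extend uℓ) (length-allCells g n)
    instance
      L≢0 : NonZero (length order)
      L≢0 = >-nonZero (∈-length {xs = order} (∈-++⁺ˡ c∈ℓ))
    open Cyclic order
    scheme : IsSeqScheme F n cyclic
    scheme k rewrite sym L≡N =
        (λ i j i<N j<N → cyclic-block-injective (extend-unique uℓ) k i<N j<N)
      , (λ c → cyclic-block-surjective k (∈-extend ℓ c))
    prefix : ∀ (i : Fin (length ℓ)) → cyclic (toℕ i) ≡ lookup ℓ i
    prefix i = lookup-++ˡ ℓ _ i (position (toℕ i)) (position-block 0 (≤-trans (toℕ<n i) (length-++-≤ˡ ℓ)))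

module Walks (F : Rule) {n : ℕ} (x : Config F n) (u : Cell (grid F) n) where

  private
    g = grid F
    C = Cell g n

  open DecMembership (cellEq? g {n}) using (_∈?_)

  InVplus? : ∀ c → Dec (InVplus F x c)
  InVplus? c = (x c Bool.≟ false) ×-dec (¬? (InI? F (nsum F x c)) ×-dec InI? F (suc (nsum F x c)))

  -- Walk c k: a walk c = c₀, c₁, …, c_k = u whose cells c₁, …, c_k lie in V₊.
  data Walk : C → ℕ → Set where
    end  : Walk u 0
    cons : ∀ {c d k} → Walk d k → InVplus F x d → c ∈ nbrs g d → Walk c (suc k)

  walk? : ∀ c k → Dec (Walk c k)
  walk? c zero with cellEq? g c u
  ... | yes refl = yes end
  ... | no c≢u   = no λ { end → c≢u refl }
  walk? c (suc k) = map′ fromAny toAny (any? (λ d → InVplus? d ×-dec walk? d k ×-dec c ∈? nbrs g d) (nbrs g c))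
    where
    fromAny : Any (λ d → InVplus F x d × Walk d k × c ∈ nbrs g d) (nbrs g c) → Walk c (suc k)
    fromAny a with _ , _ , vd , w , c∈ ← find a = cons w vd c∈
    toAny : Walk c (suc k) → Any (λ d → InVplus F x d × Walk d k × c ∈ nbrs g d) (nbrs g c)
    toAny (cons w vd c∈) = lose (nbr-sym g c∈) (vd , w , c∈)

  cells : ∀ {c k} → Walk c k → List C
  cells end              = u ∷ []
  cells {c} (cons w _ _) = c ∷ cells w

  head∈cells : ∀ {c k} (w : Walk c k) → c ∈ cells w
  head∈cells end          = here refl
  head∈cells (cons _ _ _) = here refl

  suffix : ∀ {c k e} (w : Walk c k) → e ∈ cells w → Σ ℕ λ j → j ≤ k × Walk e j
  suffix end            (here refl) = 0 , z≤n , end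
  suffix (cons w vd c∈) (here refl) = _ , ≤-refl , cons w vd c∈
  suffix (cons w _ _)   (there e∈)  with j , j≤k , we ← suffix w e∈ = j , m≤n⇒m≤1+n j≤k , we

  later-suffix : ∀ {c k e} (w : Walk c k) → e ∈ cells w → e ≢ c → Σ ℕ λ j → j < k × Walk e j
  later-suffix end          (here refl) e≢c = ⊥-elim (e≢c refl)
  later-suffix (cons _ _ _) (here refl) e≢c = ⊥-elim (e≢c refl)
  later-suffix (cons w _ _) (there e∈)  _   with j , j≤k , we ← suffix w e∈ = j , s≤s j≤k , we

  cells-in-V₊ : ∀ {c k e} → InVplus F x c → (w : Walk c k) → e ∈ cells w → InVplus F x e
  cells-in-V₊ vc end            (here refl) = vc
  cells-in-V₊ vc (cons _ _ _)   (here refl) = vc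
  cells-in-V₊ _  (cons w vd _)  (there e∈)  = cells-in-V₊ vd w e∈

  walk⇒comp : ∀ {c k} → Walk c k → InVplus F x c → InComp F x u c
  walk⇒comp end            vc = here vc
  walk⇒comp (cons w vd c∈) vc = step (walk⇒comp w vd) c∈ vc

  comp-in-V₊ : ∀ {c} → InComp F x u c → InVplus F x c
  comp-in-V₊ (here vc)     = vc
  comp-in-V₊ (step _ _ vc) = vc

  comp⇒walk : ∀ {c} → InComp F x u c → Σ ℕ (Walk c)
  comp⇒walk (here _) = 0 , end
  comp⇒walk (step cw c∈ _) with k , w ← comp⇒walk cw = suc k , cons w (comp-in-V₊ cw) c∈

  record Shortest {c k} (w : Walk c k) : Set where
    constructor shortest-by
    field no-shorter : ¬ (∃ λ j → j < k × Walk c j)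
  open Shortest

  shortest : ∀ {c k} → Walk c k → Σ ℕ λ j → Σ (Walk c j) Shortest
  shortest {c} {k} = <-rec (λ k → Walk c k → Σ ℕ λ j → Σ (Walk c j) Shortest) shorten k
    where
    shorten : ∀ k → (∀ {j} → j < k → Walk c j → Σ ℕ λ j → Σ (Walk c j) Shortest) →
              Walk c k → Σ ℕ λ j → Σ (Walk c j) Shortest
    shorten k rec w with anyUpTo? (walk? c) k
    ... | yes (j , j<k , w′) = rec j<k w′
    ... | no none            = k , w , shortest-by none

  module _ {c d k} {w : Walk d k} {vd : InVplus F x d} {c∈ : c ∈ nbrs g d}
           (sh : Shortest (cons w vd c∈)) where

    shortest-tail : Shortest w
    shortest-tail = shortest-by λ (j , j<k , w′) → no-shorter sh (suc j , s≤s j<k , cons w′ vd c∈)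

    head∉tail : c ∉ cells w
    head∉tail c∈w with j , j≤k , w′ ← suffix w c∈w = no-shorter sh (j , s≤s j≤k , w′)

    no-chord : ∀ {e} → e ∈ cells w → e ≢ d → c ∉ nbrs g e
    no-chord e∈w e≢d c∈e with j , j<k , we ← later-suffix w e∈w e≢d =
      no-shorter sh (suc j , s≤s j<k , cons we (cells-in-V₊ vd w e∈w) c∈e)

  shortest-unique : ∀ {c k} (w : Walk c k) → Shortest w → Unique (cells w)
  shortest-unique end            _  = [] ∷ []
  shortest-unique (cons w vd c∈) sh =
    All.tabulate (λ e∈w c≡e → head∉tail sh (subst (_∈ cells w) (sym c≡e) e∈w))
    ∷ shortest-unique w (shortest-tail sh)

  short-walk : ∀ {c k} → Walk c k → Σ ℕ λ j → j < size g n × Walk c j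
  short-walk w with j , w′ , sh ← shortest w =
    j , subst₂ _≤_ (length-cells w′) (length-allCells g n) (length-unique≤ (shortest-unique w′ sh)) , w′
    where
    open Enumeration (cellEq? g) (∈-allCells g) (allCells-unique g n)
    length-cells : ∀ {c k} (w : Walk c k) → length (cells w) ≡ suc k
    length-cells end          = refl
    length-cells (cons w _ _) = cong suc (length-cells w)

module Lemma3 (F : Rule) (n : ℕ) (valid : ValidSize (grid F) n)
              (x : Config F n) (u : Cell (grid F) n) (vu : InVplus F x u) where

  private
    g = grid F
    C = Cell g n

  open Dynamics F {n}
  open Walks F x u

  k₁≡1 : k₁ F ≡ 1
  k₁≡1 = proj₂ (vplus-threshold F (proj₁ (proj₂ vu)) (proj₂ (proj₂ vu)))

  open Threshold F k₁≡1

  Quiet : Config F n → C → Set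
  Quiet y e = y e ≡ false × (∀ {a} → a ∈ nbrs g e → y a ≡ false)

  V₊-quiet : ∀ {e} → InVplus F x e → Quiet x e
  V₊-quiet (xe , s∉I , 1+s∈I) =
    xe , count-zero⁻ x (nbrs g _) (proj₁ (vplus-threshold F s∉I 1+s∈I))

  activate-along : ∀ {c k} (w : Walk c k) → Shortest w → (y : Config F n) → localRule F y c ≡ true →
                   (∀ {e} → e ∈ cells w → e ≢ c → Quiet y e) → updateAlong (cells w) y u ≡ true
  activate-along end                 _  y fires _     = trans (updateAt-self {y}) fires
  activate-along {c} (cons {d = d} w vd c∈) sh y fires quiet =
    activate-along w (shortest-tail sh) y′ d-fires quiet′
    where
    y′ = updateAt F c y
    c∉w : ∀ {e} → e ∈ cells w → c ≢ e
    c∉w e∈w c≡e = head∉tail sh (subst (_∈ cells w) (sym c≡e) e∈w)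
    d-quiet : Quiet y d
    d-quiet = quiet (there (head∈cells w)) (c∉w (head∈cells w) ∘ sym)
    -- in y′ the cell c is the only active neighbour of d
    one-neighbour : nsum F y′ d ≡ 1
    one-neighbour = count-one y′ (nbrs g d) (nbrs-unique g valid d) c∈ (trans (updateAt-self {y}) fires)
      (λ a∈ a≢c → trans (updateAt-other {y} (a≢c ∘ sym)) (proj₂ d-quiet a∈))
    d-fires : localRule F y′ d ≡ true
    d-fires = localRule-infiltrates {y′} (trans (updateAt-other {y} (c∉w (head∈cells w))) (proj₁ d-quiet))
                                         (subst (InI F) (sym one-neighbour) 1∈I)
    quiet′ : ∀ {e} → e ∈ cells w → e ≢ d → Quiet y′ e
    quiet′ {e} e∈w e≢d = trans (updateAt-other {y} (c∉w e∈w)) (proj₁ q) , nbrs-inactive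
      where
      q = quiet (there e∈w) (c∉w e∈w ∘ sym)
      nbrs-inactive : ∀ {a} → a ∈ nbrs g e → y′ a ≡ false
      nbrs-inactive {a} a∈ with cellEq? g c a
      ... | yes refl = ⊥-elim (no-chord sh e∈w e≢d a∈)
      ... | no _     = proj₂ q a∈

  -- An infiltrating cell v joined to u by a walk through V₊ lets some scheme activate u:
  -- update a shortest such walk first, cell by cell.
  activating-scheme : ∀ {v k} → Walk v k → Infiltrates F x v →
                      Σ (ℕ → C) λ σ → IsSeqScheme F n σ × Σ ℕ λ t → run F σ x t u ≡ true
  activating-scheme walk (xv , v∈I) with _ , w , sh ← shortest walk
    with σ , scheme , visits ← scheme-starting-with (cells w) (shortest-unique w sh) (head∈cells w) =
    σ , scheme , length (cells w) ,
    trans (cong-app (run-along x σ (cells w) 0 visits) u)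
          (activate-along w sh x (localRule-infiltrates {x} xv v∈I) (quiet w))
    where
    quiet : ∀ {v k} (w : Walk v k) {e} → e ∈ cells w → e ≢ v → Quiet x e
    quiet end             (here refl) e≢v = ⊥-elim (e≢v refl)
    quiet (cons _ _ _)    (here refl) e≢v = ⊥-elim (e≢v refl)
    quiet (cons w′ vd′ _) (there e∈w′) _  = V₊-quiet (cells-in-V₊ vd′ w′ e∈w′)

  backward : (∃ λ v → InBorder F x u v × Infiltrates F x v) → Unstable F n x u
  backward (_ , (_ , w₀ , w₀∈V₊[u] , w₀∈N) , v-infiltrates) stable
    with _ , walk₀ ← comp⇒walk w₀∈V₊[u]
    with σ , scheme , t , u-active ← activating-scheme (cons walk₀ (comp-in-V₊ w₀∈V₊[u]) (nbr-sym g w₀∈N)) v-infiltrates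
    with () ← trans (sym u-active) (trans (stable σ scheme t) (proj₁ vu))

  Trigger : C → Set
  Trigger c = Infiltrates F x c × Σ ℕ λ k → k < size g n × Walk c k

  trigger? : ∀ c → Dec (Trigger c)
  trigger? c = (x c Bool.≟ false ×-dec InI? F (nsum F x c)) ×-dec anyUpTo? (walk? c) (size g n)

  trigger⇒border : ∀ {c} → Trigger c → InBorder F x u c
  trigger⇒border ((_ , c∈I) , _ , _ , end) = ⊥-elim (proj₁ (proj₂ vu) c∈I)
  trigger⇒border ((_ , c∈I) , _ , _ , cons w vd c∈) =
    (λ c∈V₊[u] → proj₁ (proj₂ (comp-in-V₊ c∈V₊[u])) c∈I) , _ , walk⇒comp w vd , nbr-sym g c∈

  border-overloaded : ¬ ∃ Trigger → ∀ {b} → InBorder F x u b → x b ≡ false × k₂ F < nsum F x b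
  border-overloaded no-trigger {b} (b∉V₊[u] , w , w∈V₊[u] , w∈N) =
    xb , above-I _ b∉I (λ 1+s∈I → b∉V₊[u] (step w∈V₊[u] b∈N (xb , b∉I , 1+s∈I)))
    where
    b∈N = nbr-sym g w∈N
    xb  = proj₂ (V₊-quiet (comp-in-V₊ w∈V₊[u])) b∈N
    b∉I : ¬ InI F (nsum F x b)
    b∉I b∈I with _ , w′ ← comp⇒walk w∈V₊[u] =
      no-trigger (b , (xb , b∈I) , short-walk (cons w′ (comp-in-V₊ w∈V₊[u]) b∈N))

  Closure : C → Set
  Closure c = InComp F x u c ⊎ InBorder F x u c

  neighbour-closure : ∀ {c a} → InComp F x u c → a ∈ nbrs g c → Closure a
  neighbour-closure c∈V₊[u] a∈ with InVplus? _
  ... | yes va = inj₁ (step c∈V₊[u] a∈ va)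
  ... | no ¬va = inj₂ ((¬va ∘ comp-in-V₊) , _ , c∈V₊[u] , nbr-sym g a∈)

  stable : ¬ ∃ Trigger → Stable F n x u
  stable no-trigger σ _ t = trans (stays-inactive x Closure initially closed σ t (inj₁ (here vu))) (sym (proj₁ vu))
    where
    initially : ∀ {c} → Closure c → x c ≡ false
    initially (inj₁ c∈V₊[u]) = proj₁ (comp-in-V₊ c∈V₊[u])
    initially (inj₂ c∈B[u])  = proj₁ (border-overloaded no-trigger c∈B[u])
    closed : ∀ (y : Config F n) {c} → (∀ {e} → Closure e → y e ≡ false) → (∀ {e} → x e ≡ true → y e ≡ true) →
             Closure c → localRule F y c ≡ false
    closed y off _ (inj₁ c∈V₊[u]) =
      localRule-idle {y} (off (inj₁ c∈V₊[u]))
        (subst (¬_ ∘ InI F) (sym (count-zero y (nbrs g _) (off ∘ neighbour-closure c∈V₊[u]))) 0∉I)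
    closed y off x⊆y (inj₂ c∈B[u]) =
      localRule-idle {y} (off (inj₂ c∈B[u]))
        (λ (_ , s≤k₂) → <⇒≱ (proj₂ (border-overloaded no-trigger c∈B[u]))
                              (≤-trans (count-mono x y (nbrs g _) (λ _ → x⊆y)) s≤k₂))

  forward : Unstable F n x u → ∃ λ v → InBorder F x u v × Infiltrates F x v
  forward unstable with any? trigger? (allCells g n)
  ... | yes some = let (v , _ , t) = find some in v , trigger⇒border t , proj₁ t
  ... | no none  = ⊥-elim (unstable (stable (λ (c , t) → none (lose (∈-allCells g c) t))))

lemma3 : (F : Rule) (n : ℕ) → ValidSize (grid F) n →
    (x : Config F n) (u : Cell (grid F) n) → InVplus F x u →
    Unstable F n x u ⇔ (∃ λ v → InBorder F x u v × Infiltrates F x v)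
lemma3 F n valid x u vu = mk⇔ forward backward
  where open Lemma3 F n valid x u vu
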